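{- Let $\mathbb{F}$ be a field. There are noncommutative p-families $f=(f_n)$ and $g=(g_n)$ such that $g\leq_{abp} f$, but $f\not\leq_{iproj} g$ and $g\not\leq_{iproj} f$.
   Context: A p-family is a sequence $f=(f_n)$ of noncommutative polynomials $f_n\in\mathbb{F}\langle X_n\rangle$ whose number of variables and degree are bounded by $n^c$. For $f_n\in\mathbb{F}\langle X_n\rangle$ and $g_n\in\mathbb{F}\langle Y_n\rangle$ with $\deg g_n=d'_n$: $f\leq_{iproj} g$ if there are a polynomial $p(n)$ and maps $\phi:[d'_{p(n)}]\times Y_{p(n)}\to X_n\cup\mathbb{F}$ such that substituting $\phi(i,y)$ for each variable $y$ occurring in position $i$ of each monomial of $g_{p(n)}$ yields $f_n$; $f\leq_{abp} g$ if there are polynomials $p(n),q(n)$ and maps $\phi$ sending each variable of $Y_{p(n)}$ to a $q(n)\times q(n)$ matrix with entries field elements or variables of $X_n$ (the paper also allows constant-degree monomials over $X_n$), such that $f_n$ is the $(1,q(n))$ entry of $g_{p(n)}(\phi(Y_{p(n)}))$. -}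

module Defs where

open import Level using (Level; _⊔_; suc)
open import Algebra.Bundles using (CommutativeRing)
open import Data.Nat as ℕ using (ℕ; zero)
open import Data.Fin as Fin using (Fin)
open import Data.List using (List; []; _∷_; length; map; concatMap; foldr; _++_; allFin)
open import Data.List.Properties using (≡-dec)
open import Data.Product using (Σ; ∃; _×_; _,_; proj₁; proj₂)
open import Data.Sum using (_⊎_; inj₁; inj₂)
open import Relation.Nullary using (¬_; yes; no)
open import Relation.Binary.PropositionalEquality using (_≡_)

record Field (c ℓ : Level) : Set (Level.suc (c ⊔ ℓ)) where
  field
    commutativeRing : CommutativeRing c ℓ
  open CommutativeRing commutativeRing public
  field
    0≉1     : ¬ (0# ≈ 1#)
    inverse : ∀ x → ¬ (x ≈ 0#) → Σ Carrier λ y → (x * y) ≈ 1#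

PolyFun : Set
PolyFun = List ℕ

evalPF : PolyFun → ℕ → ℕ
evalPF []       n = 0
evalPF (a ∷ as) n = a ℕ.+ n ℕ.* evalPF as n

module NC {c ℓ} (F : Field c ℓ) where
  open Field F

  Word : ℕ → Set
  Word k = List (Fin k)

  -- A polynomial in F⟨x₀,…,x_{k-1}⟩, given as a finite formal sum of
  -- (coefficient, monomial) terms; equality is coefficientwise (_≋_).
  Poly : ℕ → Set c
  Poly k = List (Carrier × Word k)

  coeff : ∀ {k} → Poly k → Word k → Carrier
  coeff []             w = 0#
  coeff ((a , u) ∷ p) w with ≡-dec Fin._≟_ u w
  ... | yes _ = a + coeff p w
  ... | no  _ = coeff p w

  _≋_ : ∀ {k} → Poly k → Poly k → Set ℓ
  p ≋ q = ∀ w → coeff p w ≈ coeff q w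

  0P : ∀ {k} → Poly k
  0P = []

  1P : ∀ {k} → Poly k
  1P = (1# , []) ∷ []

  _+P_ : ∀ {k} → Poly k → Poly k → Poly k
  p +P q = p ++ q

  _*P_ : ∀ {k} → Poly k → Poly k → Poly k
  p *P q = concatMap (λ t → map (λ s → (proj₁ t * proj₁ s , proj₂ t ++ proj₂ s)) q) p

  scale : ∀ {k} → Carrier → Poly k → Poly k
  scale a p = map (λ t → (a * proj₁ t , proj₂ t)) p

  sumP : ∀ {k} → List (Poly k) → Poly k
  sumP = foldr _+P_ 0P

  atom : ∀ {k} → Fin k ⊎ Carrier → Poly k
  atom (inj₁ x) = (1# , x ∷ []) ∷ []
  atom (inj₂ a) = (a , []) ∷ []

  DegreeAtMost : ∀ {k} → Poly k → ℕ → Set ℓ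
  DegreeAtMost p d = ∀ w → d ℕ.< length w → coeff p w ≈ 0#

  record PFamily : Set (c ⊔ ℓ) where
    field
      nv    : ℕ → ℕ
      poly  : (n : ℕ) → Poly (nv n)
      bound : Σ ℕ λ e → ∀ n → (nv n ℕ.≤ e ℕ.+ n ℕ.^ e) × DegreeAtMost (poly n) (e ℕ.+ n ℕ.^ e)
  open PFamily public

  -- Index-dependent projection substitution: the variable y at position i
  -- (positions counted from 0) of a monomial is replaced by φ i y.

  iprojWord : ∀ {k m} → (ℕ → Fin m → Fin k ⊎ Carrier) → ℕ → Word m → Poly k
  iprojWord φ i []       = 1P
  iprojWord φ i (y ∷ w) = atom (φ i y) *P iprojWord φ (ℕ.suc i) w

  iprojSubst : ∀ {k m} → (ℕ → Fin m → Fin k ⊎ Carrier) → Poly m → Poly k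
  iprojSubst φ g = concatMap (λ t → scale (proj₁ t) (iprojWord φ 0 (proj₂ t))) g

  _≤iproj_ : PFamily → PFamily → Set (c ⊔ ℓ)
  f ≤iproj g = Σ PolyFun λ p → ∀ n →
    Σ (ℕ → Fin (nv g (evalPF p n)) → Fin (nv f n) ⊎ Carrier) λ φ →
      iprojSubst φ (poly g (evalPF p n)) ≋ poly f n

  -- ABP substitution: each variable y is replaced by a d×d matrix φ y with
  -- entries in X ∪ F; (i,j) entry of the product of matrices along a word.

  Mat : ℕ → ℕ → Set c
  Mat k d = Fin d → Fin d → Fin k ⊎ Carrier

  matWord : ∀ {k m d} → (Fin m → Mat k d) → Word m → Fin d → Fin d → Poly k
  matWord φ []       i j with i Fin.≟ j
  ... | yes _ = 1P
  ... | no  _ = 0P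
  matWord {d = d} φ (y ∷ w) i j =
    sumP (map (λ l → atom (φ y i l) *P matWord φ w l j) (allFin d))

  matSubst : ∀ {k m d} → (Fin m → Mat k d) → Poly m → Fin d → Fin d → Poly k
  matSubst φ g i j = concatMap (λ t → scale (proj₁ t) (matWord φ (proj₂ t) i j)) g

  _≤abp_ : PFamily → PFamily → Set (c ⊔ ℓ)
  f ≤abp g = Σ PolyFun λ p → Σ PolyFun λ q → ∀ n →
    Σ (Fin (nv g (evalPF p n)) → Mat (nv f n) (ℕ.suc (evalPF q n))) λ φ →
      matSubst φ (poly g (evalPF p n)) Fin.zero (Fin.fromℕ (evalPF q n)) ≋ poly f n

-- Take f = x² and g = 1 + x in one variable. The 2×2 matrix M = [[1,1],[0,x]] has
-- M² = [[1,1+x],[0,x²]], so substituting M into f gives g as an ABP entry. An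
-- index-dependent projection sends each monomial to a single scaled monomial of no
-- larger degree: so the degree-one g cannot project onto x², and the single monomial
-- x² cannot project onto the two-term polynomial 1 + x.
module Submission where

open import Defs
open import Data.Product using (Σ; ∃; _×_; _,_; proj₁; proj₂)
open import Relation.Nullary using (¬_; yes; no)
open import Data.Fin as Fin using (Fin; zero; suc)
open import Data.List using ([]; _∷_; _++_; length; map)
open import Data.List.Properties using (≡-dec; length-++; ++-identityʳ)
open import Data.List.Relation.Unary.All as All using (All; []; _∷_)
open import Data.List.Relation.Unary.All.Properties using (map⁺; concat⁺)
open import Data.Sum using (_⊎_; inj₁; inj₂)
open import Data.Nat as ℕ using (ℕ; _≤_; z≤n)
open import Data.Nat.Properties using (≤⇒≯; ≤-refl; ≤-trans; m≤m+n; m≤n+m; +-mono-≤; *-zeroʳ)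
open import Data.Empty using (⊥-elim)
open import Relation.Binary.PropositionalEquality using (_≡_; _≢_; refl; sym; subst)

module Separation {c ℓ} (F : Field c ℓ) where
  open Field F hiding (zero; refl; sym; trans)
  open Field F using () renaming (refl to ≈-refl; sym to ≈-sym; trans to ≈-trans)
  open NC F

  TermsOfLengthAtMost : ∀ {k} → ℕ → Poly k → Set c
  TermsOfLengthAtMost d p = All (λ t → length (proj₂ t) ≤ d) p

  termsOfLengthAtMost-mono : ∀ {k d e} {p : Poly k} →
    d ≤ e → TermsOfLengthAtMost d p → TermsOfLengthAtMost e p
  termsOfLengthAtMost-mono d≤e = All.map (λ h → ≤-trans h d≤e)

  termsOfLengthAtMost⇒degreeAtMost : ∀ {k d} (p : Poly k) →
    TermsOfLengthAtMost d p → DegreeAtMost p d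
  termsOfLengthAtMost⇒degreeAtMost []            []       w d<w = ≈-refl
  termsOfLengthAtMost⇒degreeAtMost ((a , u) ∷ p) (h ∷ hs) w d<w with ≡-dec Fin._≟_ u w
  ... | yes refl = ⊥-elim (≤⇒≯ h d<w)
  ... | no  _    = termsOfLengthAtMost⇒degreeAtMost p hs w d<w

  atom-termsOfLengthAtMost : ∀ {k} (a : Fin k ⊎ Carrier) → TermsOfLengthAtMost 1 (atom a)
  atom-termsOfLengthAtMost (inj₁ _) = ≤-refl ∷ []
  atom-termsOfLengthAtMost (inj₂ _) = z≤n ∷ []

  *P-termsOfLengthAtMost : ∀ {k d e} (p q : Poly k) →
    TermsOfLengthAtMost d p → TermsOfLengthAtMost e q →
    TermsOfLengthAtMost (d ℕ.+ e) (p *P q)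
  *P-termsOfLengthAtMost p q hp hq = concat⁺ (map⁺ (All.map termTimesQ hp))
    where
    termTimesQ : ∀ {t} → length (proj₂ t) ≤ _ →
      All (λ s → length (proj₂ s) ≤ _) (map (λ s → (proj₁ t * proj₁ s , proj₂ t ++ proj₂ s)) q)
    termTimesQ {t} ht = map⁺ (All.map (λ hs →
      subst (_≤ _) (sym (length-++ (proj₂ t))) (+-mono-≤ ht hs)) hq)

  scale-termsOfLengthAtMost : ∀ {k d} a (p : Poly k) →
    TermsOfLengthAtMost d p → TermsOfLengthAtMost d (scale a p)
  scale-termsOfLengthAtMost a p hp = map⁺ hp

  iprojWord-termsOfLengthAtMost : ∀ {k m} (φ : ℕ → Fin m → Fin k ⊎ Carrier) i w →
    TermsOfLengthAtMost (length w) (iprojWord φ i w)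
  iprojWord-termsOfLengthAtMost φ i []      = z≤n ∷ []
  iprojWord-termsOfLengthAtMost φ i (y ∷ w) =
    *P-termsOfLengthAtMost (atom (φ i y)) (iprojWord φ (ℕ.suc i) w)
      (atom-termsOfLengthAtMost (φ i y)) (iprojWord-termsOfLengthAtMost φ (ℕ.suc i) w)

  iprojSubst-termsOfLengthAtMost : ∀ {k m d} (φ : ℕ → Fin m → Fin k ⊎ Carrier) (g : Poly m) →
    TermsOfLengthAtMost d g → TermsOfLengthAtMost d (iprojSubst φ g)
  iprojSubst-termsOfLengthAtMost φ g hg = concat⁺ (map⁺ (All.map (λ {t} ht →
    scale-termsOfLengthAtMost (proj₁ t) _
      (termsOfLengthAtMost-mono ht (iprojWord-termsOfLengthAtMost φ 0 (proj₂ t)))) hg))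

  IsMonomial : ∀ {k} → Poly k → Set c
  IsMonomial p = ∃ λ t → p ≡ t ∷ []

  atom-isMonomial : ∀ {k} (a : Fin k ⊎ Carrier) → IsMonomial (atom a)
  atom-isMonomial (inj₁ _) = _ , refl
  atom-isMonomial (inj₂ _) = _ , refl

  *P-isMonomial : ∀ {k} {p q : Poly k} → IsMonomial p → IsMonomial q → IsMonomial (p *P q)
  *P-isMonomial (_ , refl) (_ , refl) = _ , refl

  iprojWord-isMonomial : ∀ {k m} (φ : ℕ → Fin m → Fin k ⊎ Carrier) i w →
    IsMonomial (iprojWord φ i w)
  iprojWord-isMonomial φ i []      = _ , refl
  iprojWord-isMonomial φ i (y ∷ w) =
    *P-isMonomial (atom-isMonomial (φ i y)) (iprojWord-isMonomial φ (ℕ.suc i) w)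

  iprojSubst-isMonomial : ∀ {k m} (φ : ℕ → Fin m → Fin k ⊎ Carrier) (t : Carrier × Word m) →
    IsMonomial (iprojSubst φ (t ∷ []))
  iprojSubst-isMonomial φ (a , w) with iprojWord-isMonomial φ 0 w
  ... | s , eq rewrite eq = _ , ++-identityʳ (scale a (s ∷ []))

  isMonomial-coeff : ∀ {k} {p : Poly k} {u v : Word k} → IsMonomial p → u ≢ v →
    coeff p u ≈ 0# ⊎ coeff p v ≈ 0#
  isMonomial-coeff {u = u} {v} ((a , w) , refl) u≢v with ≡-dec Fin._≟_ w u
  ... | no  _    = inj₁ ≈-refl
  ... | yes refl with ≡-dec Fin._≟_ w v
  ...   | yes w≡v = ⊥-elim (u≢v w≡v)
  ...   | no  _   = inj₂ ≈-refl

  constantFamily : ∀ {k} d (p : Poly k) → TermsOfLengthAtMost d p → PFamily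
  constantFamily {k} d p hp = record
    { nv    = λ _ → k
    ; poly  = λ _ → p
    ; bound = k ℕ.+ d , λ n →
        ≤-trans (m≤m+n k d) (m≤m+n _ _) ,
        termsOfLengthAtMost⇒degreeAtMost p
          (termsOfLengthAtMost-mono (≤-trans (m≤n+m d k) (m≤m+n _ _)) hp)
    }

  x : Fin 1
  x = zero

  xSquared : Poly 1
  xSquared = (1# , x ∷ x ∷ []) ∷ []

  onePlusX : Poly 1
  onePlusX = (1# , []) ∷ (1# , x ∷ []) ∷ []

  f g : PFamily
  f = constantFamily 2 xSquared (≤-refl ∷ [])
  g = constantFamily 1 onePlusX (z≤n ∷ ≤-refl ∷ [])

  upperTriangularX : Mat 1 2
  upperTriangularX zero       zero       = inj₂ 1#
  upperTriangularX zero       (suc zero) = inj₂ 1#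
  upperTriangularX (suc zero) zero       = inj₂ 0#
  upperTriangularX (suc zero) (suc zero) = inj₁ x

  1·1·1·1≈1 : 1# * (1# * (1# * 1#)) ≈ 1#
  1·1·1·1≈1 = ≈-trans (*-identityˡ _) (≈-trans (*-identityˡ _) (*-identityˡ _))

  square-upperTriangularX : matSubst (λ _ → upperTriangularX) xSquared zero (suc zero) ≋ onePlusX
  square-upperTriangularX []                       = +-congʳ 1·1·1·1≈1
  square-upperTriangularX (zero ∷ [])              = +-congʳ 1·1·1·1≈1
  square-upperTriangularX (zero ∷ zero ∷ [])       = ≈-refl
  square-upperTriangularX (zero ∷ zero ∷ zero ∷ _) = ≈-refl

  g≤abpf : g ≤abp f
  g≤abpf = [] , 1 ∷ [] , squareAtSizeTwo
    where
    squareAtSizeTwo : ∀ n → Σ (Fin 1 → Mat 1 (ℕ.suc (evalPF (1 ∷ []) n))) λ φ →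
      matSubst φ xSquared zero (Fin.fromℕ (evalPF (1 ∷ []) n)) ≋ onePlusX
    squareAtSizeTwo n rewrite *-zeroʳ n = (λ _ → upperTriangularX) , square-upperTriangularX

  1+0≉0 : ¬ (1# + 0# ≈ 0#)
  1+0≉0 e = 0≉1 (≈-sym (≈-trans (≈-sym (+-identityʳ 1#)) e))

  f≰iprojg : ¬ (f ≤iproj g)
  f≰iprojg (_ , reduction) with reduction 0
  ... | φ , image≋xSquared = 1+0≉0 (≈-trans (≈-sym (image≋xSquared (x ∷ x ∷ [])))
          (termsOfLengthAtMost⇒degreeAtMost (iprojSubst φ onePlusX)
            (iprojSubst-termsOfLengthAtMost φ onePlusX (z≤n ∷ ≤-refl ∷ [])) (x ∷ x ∷ []) ≤-refl))

  g≰iprojf : ¬ (g ≤iproj f)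
  g≰iprojf (_ , reduction) with reduction 0
  ... | φ , image≋onePlusX with isMonomial-coeff {u = []} {v = x ∷ []}
                                   (iprojSubst-isMonomial φ (1# , x ∷ x ∷ [])) (λ ())
  ...   | inj₁ coeff[]≈0  = 1+0≉0 (≈-trans (≈-sym (image≋onePlusX [])) coeff[]≈0)
  ...   | inj₂ coeff[x]≈0 = 1+0≉0 (≈-trans (≈-sym (image≋onePlusX (x ∷ []))) coeff[x]≈0)

mainTheorem14 : ∀ {c ℓ} (F : Field c ℓ) → let open NC F in
    Σ PFamily λ f → Σ PFamily λ g → (g ≤abp f) × ¬ (f ≤iproj g) × ¬ (g ≤iproj f)
mainTheorem14 F = f , g , g≤abpf , f≰iprojg , g≰iprojf
  where open Separation F
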